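{- Let $G$ be a group with identity $1_G$ and let $A\subseteq G$ be a finite subset. Put $A_{>2}=\{a\in A: a^{ -1}\ne a\}$, $A_2=\{a\in A: a^{ -1}=a\ne 1_G\}$ and $A_{>1}=\{a\in A: a\ne 1_G\}$. Then $$\Delta[A]\ge \frac{1+\sqrt{4|A_{>2}|+8|A_2|+1}}{2}\ge \frac{1+\sqrt{4|A_{>1}|+1}}{2}.$$
   Context: For a subset $A$ of a group $G$, a subset $B\subseteq G$ is a difference basis for $A$ if every $a\in A$ can be written as $a=xy^{ -1}$ with $x,y\in B$. The difference size $\Delta[A]$ is the smallest cardinality of a difference basis for $A$. -}

module Defs where

open import Level using (Level; _⊔_)
open import Algebra.Bundles using (Group)
open import Data.Nat using (ℕ; _≤_)
open import Data.List using (List; length)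
open import Data.Product using (Σ; ∃; _×_; _,_)
open import Function.Bundles using (_⇔_)
open import Relation.Nullary using (¬_)
open import Relation.Binary.PropositionalEquality using (_≡_)
import Data.List.Membership.Setoid as SetoidMembership
import Data.List.Relation.Unary.Unique.Setoid as SetoidUnique

module _ {c ℓ : Level} (G : Group c ℓ) where
  open Group G
  open SetoidMembership setoid using (_∈_)
  open SetoidUnique setoid using (Unique)

  -- A finite subset of G is a duplicate-free list (up to ≈) of elements of G.
  -- B is a difference basis for A: every a ∈ A is x ∙ y ⁻¹ with x, y ∈ B.
  IsDiffBasis : List Carrier → List Carrier → Set (c ⊔ ℓ)
  IsDiffBasis A B = ∀ a → a ∈ A → Σ Carrier λ x → Σ Carrier λ y →
                      x ∈ B × y ∈ B × a ≈ x ∙ y ⁻¹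

  IsDifferenceSize : List Carrier → ℕ → Set (c ⊔ ℓ)
  IsDifferenceSize A n =
    (Σ (List Carrier) λ B → Unique B × IsDiffBasis A B × length B ≡ n)
    × (∀ B → Unique B → IsDiffBasis A B → n ≤ length B)

  HasCard : (Carrier → Set (c ⊔ ℓ)) → ℕ → Set (c ⊔ ℓ)
  HasCard S k = Σ (List Carrier) λ L →
                  Unique L × length L ≡ k
                  × (∀ x → (x ∈ L) ⇔ S x)

  A>2 : List Carrier → Carrier → Set (c ⊔ ℓ)
  A>2 A a = a ∈ A × ¬ (a ⁻¹ ≈ a)

  A=2 : List Carrier → Carrier → Set (c ⊔ ℓ)
  A=2 A a = a ∈ A × (a ⁻¹ ≈ a) × ¬ (a ≈ ε)

  A>1 : List Carrier → Carrier → Set (c ⊔ ℓ)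
  A>1 A a = a ∈ A × ¬ (a ≈ ε)

-- Let B be a difference basis of A with n elements. Among the n² pairs (x, y) ∈ B × B,
-- the n diagonal ones all give x y⁻¹ = 1, each a ∈ A_{>2} needs a pair giving it, and
-- each involution a ∈ A_2 needs two: if x y⁻¹ = a then y x⁻¹ = a⁻¹ = a, and (x, y) ≠ (y, x)
-- because a ≠ 1. These pairs are all distinct, so |A_{>2}| + 2|A_2| + n ≤ n², which is
-- (2n − 1)² ≥ 4|A_{>2}| + 8|A_2| + 1. The second inequality is |A_{>1}| ≤ |A_{>2}| + |A_2|.
module Submission where

open import Defs
open import Level using (Level)
open import Algebra.Bundles using (Group)
open import Data.Nat using (ℕ; _≤_; _+_; _*_; _∸_; _^_; zero; suc; NonZero; >-nonZero)
open import Data.Nat.Properties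
  using (≤-trans; +-monoˡ-≤; *-monoʳ-≤; +-cancelʳ-≤; m≤m+n; *-suc; _≤?_; module ≤-Reasoning)
open import Data.Nat.Tactic.RingSolver using (solve-∀)
open import Data.List using (List; []; _∷_; _++_; length; lookup)
open import Data.List.Properties using (length-++)
open import Data.List.Relation.Unary.Any using (here; index)
open import Data.List.Relation.Unary.Any.Properties using (lookup-index)
import Data.List.Relation.Unary.All as All
open import Data.List.Relation.Unary.AllPairs using (_∷_)
import Data.List.Membership.Setoid as SetoidMembership
import Data.List.Membership.Setoid.Properties as SetoidMembershipₚ
import Data.List.Membership.Propositional.Properties as Membershipₚ
import Data.List.Relation.Unary.Unique.Setoid as SetoidUnique
open import Data.Fin using (Fin; zero; suc)
open import Data.Fin.Properties using (injective⇒≤; +↔⊎; *↔×)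
open import Data.Product using (Σ; _×_; _,_; proj₁; proj₂; swap)
open import Data.Sum using (_⊎_; inj₁; inj₂; [_,_]; reduce)
open import Data.Sum.Function.Propositional using (_⊎-↔_)
open import Function using (_∘_)
open import Function.Bundles using (_↔_; _↣_; _⇔_; Injection; Equivalence; mk↣)
open import Function.Definitions using (Injective)
open import Function.Construct.Composition using (_↔-∘_; _↣-∘_)
open import Function.Properties.Inverse using (↔-refl; ↔-sym; ↔⇒↣)
open import Relation.Binary.Bundles using (Setoid)
open import Relation.Binary.PropositionalEquality using (_≡_; _≢_; cong; subst)
import Relation.Binary.PropositionalEquality as ≡
open import Relation.Nullary using (¬_; yes; no; contradiction)
open import Relation.Nullary.Decidable using (decidable-stable; ¬¬-excluded-middle)
open import Relation.Nullary.Negation using (¬¬-map)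

private
  variable
    a b p : Level
    A B C : Set a
    m n : ℕ

↣⇒≤ : Fin m ↔ A → Fin n ↔ B → A ↣ B → m ≤ n
↣⇒≤ m↔A n↔B A↣B =
  injective⇒≤ (Injection.injective (↔⇒↣ (↔-sym n↔B) ↣-∘ (A↣B ↣-∘ ↔⇒↣ m↔A)))

+↔⊎-cong : Fin m ↔ A → Fin n ↔ B → Fin (m + n) ↔ (A ⊎ B)
+↔⊎-cong m↔A n↔B = (m↔A ⊎-↔ n↔B) ↔-∘ +↔⊎

[,]-injective : {f : A → C} {g : B → C} →
                Injective _≡_ _≡_ f → Injective _≡_ _≡_ g → (∀ x y → f x ≢ g y) →
                Injective _≡_ _≡_ [ f , g ]
[,]-injective f-inj g-inj f≢g {inj₁ x} {inj₁ x′} e = cong inj₁ (f-inj e)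
[,]-injective f-inj g-inj f≢g {inj₁ x} {inj₂ y}  e = contradiction e (f≢g x y)
[,]-injective f-inj g-inj f≢g {inj₂ y} {inj₁ x}  e = contradiction (≡.sym e) (f≢g x y)
[,]-injective f-inj g-inj f≢g {inj₂ y} {inj₂ y′} e = cong inj₂ (g-inj e)

separated-by : {f : A → C} {g : B → C} (P : C → Set p) →
               (∀ x → ¬ P (f x)) → (∀ y → P (g y)) → ∀ x y → f x ≢ g y
separated-by P ¬Pf Pg x y e = ¬Pf x (subst P (≡.sym e) (Pg y))

¬¬-pull-Fin : ∀ n {P : Fin n → Set p} → (∀ i → ¬ ¬ P i) → ¬ ¬ (∀ i → P i)
¬¬-pull-Fin zero    ¬¬P k = k λ ()
¬¬-pull-Fin (suc n) ¬¬P k = ¬¬P zero λ P₀ → ¬¬-pull-Fin n (¬¬P ∘ suc) λ Pₛ →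
  k λ { zero → P₀ ; (suc i) → Pₛ i }

module _ {c ℓ : Level} (S : Setoid c ℓ) where
  open Setoid S
  open SetoidMembership S using (_∈_)
  open SetoidUnique S using (Unique)

  lookup-injective : ∀ {xs} → Unique xs → Injective _≡_ _≈_ (lookup xs)
  lookup-injective {_ ∷ _}  (_ ∷ _)     {zero}  {zero}  _ = ≡.refl
  lookup-injective {_ ∷ xs} (x≉xs ∷ _)  {zero}  {suc j} e =
    contradiction e (All.lookup x≉xs (Membershipₚ.∈-lookup {xs = xs} j))
  lookup-injective {_ ∷ xs} (x≉xs ∷ _)  {suc i} {zero}  e =
    contradiction (sym e) (All.lookup x≉xs (Membershipₚ.∈-lookup {xs = xs} i))
  lookup-injective {_ ∷ _}  (_ ∷ xs-uniq) {suc i} {suc j} e = cong suc (lookup-injective xs-uniq e)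

  -- Classically: a duplicate-free list contained in ys is no longer than ys. The ¬¬ costs nothing
  -- because ≤ is decidable, and lets membership in ys be split by excluded middle.
  length-≤-if-¬¬⊆ : ∀ {xs ys} → Unique xs → (∀ {x} → x ∈ xs → ¬ ¬ (x ∈ ys)) →
                    length xs ≤ length ys
  length-≤-if-¬¬⊆ {xs} {ys} xs-uniq xs⊆ys = decidable-stable (length xs ≤? length ys) λ xs≰ys →
    ¬¬-pull-Fin (length xs) (λ i → xs⊆ys (SetoidMembershipₚ.∈-lookup S xs i)) λ position →
      xs≰ys (injective⇒≤ {f = index ∘ position} λ {i} {j} e →
        lookup-injective xs-uniq (trans (lookup-index (position i))
          (trans (reflexive (cong (lookup ys) e)) (sym (lookup-index (position j))))))

module _ {c ℓ : Level} (G : Group c ℓ) where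
  open Group G
  open SetoidMembership setoid using (_∈_)
  open SetoidUnique setoid using (Unique)
  open import Algebra.Properties.Group G using (ε⁻¹≈ε; ⁻¹-anti-homo-//; //-cong₂)

  SelfInverse : Carrier → Set ℓ
  SelfInverse x = x ⁻¹ ≈ x

  selfInverse-resp : ∀ {x y} → x ≈ y → SelfInverse x → SelfInverse y
  selfInverse-resp x≈y x⁻¹≈x = trans (⁻¹-cong (sym x≈y)) (trans x⁻¹≈x x≈y)

  ≈ε⇒selfInverse : ∀ {x} → x ≈ ε → SelfInverse x
  ≈ε⇒selfInverse x≈ε = selfInverse-resp (sym x≈ε) ε⁻¹≈ε

  Pair : List Carrier → Set
  Pair B = Fin (length B) × Fin (length B)

  difference : (B : List Carrier) → Pair B → Carrier
  difference B (i , j) = lookup B i // lookup B j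

  module _ (B : List Carrier) where

    difference-swap : ∀ ij → difference B (swap ij) ≈ difference B ij ⁻¹
    difference-swap (i , j) = sym (⁻¹-anti-homo-// (lookup B i) (lookup B j))

    difference-diagonal : ∀ i → difference B (i , i) ≈ ε
    difference-diagonal i = inverseʳ (lookup B i)

    difference-swap-fixed : ∀ ij → ij ≡ swap ij → difference B ij ≈ ε
    difference-swap-fixed (i , j) e =
      trans (//-cong₂ refl (reflexive (cong (lookup B) (≡.sym (cong proj₁ e)))))
            (difference-diagonal i)

    injective-if-represents : ∀ {L} → Unique L → (rep : Fin (length L) → Pair B) →
                              (∀ i → lookup L i ≈ difference B (rep i)) → Injective _≡_ _≡_ rep
    injective-if-represents L-uniq rep represents {i} {j} e = lookup-injective setoid L-uniq
      (trans (represents i) (trans (reflexive (cong (difference B) e)) (sym (represents j))))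

  basis-nonZero : ∀ {A B} → A ≢ [] → IsDiffBasis G A B → NonZero (length B)
  basis-nonZero {[]}    A≢[] basis = contradiction ≡.refl A≢[]
  basis-nonZero {a ∷ _} A≢[] basis with basis a (here refl)
  ... | _ , _ , x∈B , _ = >-nonZero (SetoidMembershipₚ.∈-length setoid x∈B)

  module _ {A B : List Carrier} (basis : IsDiffBasis G A B) where

    represent : ∀ {a} → a ∈ A → Σ (Pair B) λ ij → a ≈ difference B ij
    represent {a} a∈A with basis a a∈A
    ... | _ , _ , x∈B , y∈B , a≈x/y =
      (index x∈B , index y∈B) , trans a≈x/y (//-cong₂ (lookup-index x∈B) (lookup-index y∈B))

    module _ {L>2 L₂ : List Carrier}
             (L>2-unique : Unique L>2) (L>2⊆A>2 : ∀ {x} → x ∈ L>2 → A>2 G A x)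
             (L₂-unique : Unique L₂) (L₂⊆A₂ : ∀ {x} → x ∈ L₂ → A=2 G A x) where

      lookup>2 : ∀ i → A>2 G A (lookup L>2 i)
      lookup>2 i = L>2⊆A>2 (SetoidMembershipₚ.∈-lookup setoid L>2 i)

      lookup₂ : ∀ i → A=2 G A (lookup L₂ i)
      lookup₂ i = L₂⊆A₂ (SetoidMembershipₚ.∈-lookup setoid L₂ i)

      rep>2 : Fin (length L>2) → Pair B
      rep>2 i = proj₁ (represent (proj₁ (lookup>2 i)))

      rep₂ : Fin (length L₂) → Pair B
      rep₂ i = proj₁ (represent (proj₁ (lookup₂ i)))

      rep>2-represents : ∀ i → lookup L>2 i ≈ difference B (rep>2 i)
      rep>2-represents i = proj₂ (represent (proj₁ (lookup>2 i)))

      rep₂± : Fin (length L₂) ⊎ Fin (length L₂) → Pair B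
      rep₂± = [ rep₂ , swap ∘ rep₂ ]

      rep₂±-represents : ∀ k → lookup L₂ (reduce k) ≈ difference B (rep₂± k)
      rep₂±-represents (inj₁ i) = proj₂ (represent (proj₁ (lookup₂ i)))
      rep₂±-represents (inj₂ i) = trans (sym (proj₁ (proj₂ (lookup₂ i))))
        (trans (⁻¹-cong (rep₂±-represents (inj₁ i))) (sym (difference-swap B (rep₂ i))))

      rep>2-not-selfInverse : ∀ i → ¬ SelfInverse (difference B (rep>2 i))
      rep>2-not-selfInverse i =
        proj₂ (lookup>2 i) ∘ selfInverse-resp (sym (rep>2-represents i))

      rep₂±-selfInverse : ∀ k → SelfInverse (difference B (rep₂± k))
      rep₂±-selfInverse k = selfInverse-resp (rep₂±-represents k) (proj₁ (proj₂ (lookup₂ (reduce k))))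

      rep₂±-≉ε : ∀ k → ¬ difference B (rep₂± k) ≈ ε
      rep₂±-≉ε k = proj₂ (proj₂ (lookup₂ (reduce k))) ∘ trans (rep₂±-represents k)

      rep₂-injective : Injective _≡_ _≡_ rep₂
      rep₂-injective = injective-if-represents B L₂-unique rep₂ (rep₂±-represents ∘ inj₁)

      rep₂≢swap-rep₂ : ∀ i j → rep₂ i ≢ swap (rep₂ j)
      rep₂≢swap-rep₂ i j e with lookup-injective setoid L₂-unique
        (trans (rep₂±-represents (inj₁ i))
          (trans (reflexive (cong (difference B) e)) (sym (rep₂±-represents (inj₂ j)))))
      ... | ≡.refl = rep₂±-≉ε (inj₁ i) (difference-swap-fixed B (rep₂ i) e)

      rep₂±-injective : Injective _≡_ _≡_ rep₂±
      rep₂±-injective = [,]-injective rep₂-injective (rep₂-injective ∘ cong swap) rep₂≢swap-rep₂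

      rep>2-injective : Injective _≡_ _≡_ rep>2
      rep>2-injective = injective-if-represents B L>2-unique rep>2 rep>2-represents

      diagonal : Fin (length B) → Pair B
      diagonal i = i , i

      representing-pairs :
        (Fin (length L>2) ⊎ (Fin (length L₂) ⊎ Fin (length L₂))) ⊎ Fin (length B) → Pair B
      representing-pairs = [ [ rep>2 , rep₂± ] , diagonal ]

      representing-pairs-injective : Injective _≡_ _≡_ representing-pairs
      representing-pairs-injective =
        [,]-injective
          ([,]-injective rep>2-injective rep₂±-injective
            (separated-by (SelfInverse ∘ difference B) rep>2-not-selfInverse rep₂±-selfInverse))
          (cong proj₁)
          (separated-by ((_≈ ε) ∘ difference B)
            [ (λ i → rep>2-not-selfInverse i ∘ ≈ε⇒selfInverse) , rep₂±-≉ε ]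
            (difference-diagonal B))

      basis-count : length L>2 + (length L₂ + length L₂) + length B ≤ length B * length B
      basis-count =
        ↣⇒≤ (+↔⊎-cong (+↔⊎-cong ↔-refl +↔⊎) ↔-refl) *↔× (mk↣ representing-pairs-injective)

  A>1-count : ∀ {A L>1 L>2 L₂} → Unique L>1 → (∀ {x} → x ∈ L>1 → A>1 G A x) →
              (∀ {x} → A>2 G A x → x ∈ L>2) → (∀ {x} → A=2 G A x → x ∈ L₂) →
              length L>1 ≤ length L>2 + length L₂
  A>1-count {L>1 = L>1} {L>2} {L₂} L>1-unique L>1⊆A>1 A>2⊆L>2 A₂⊆L₂ =
    subst (length L>1 ≤_) (length-++ L>2) (length-≤-if-¬¬⊆ setoid L>1-unique classify)
    where
    classify : ∀ {x} → x ∈ L>1 → ¬ ¬ (x ∈ L>2 ++ L₂)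
    classify x∈L>1 with L>1⊆A>1 x∈L>1
    ... | x∈A , x≉ε = ¬¬-map
      (λ { (yes x⁻¹≈x) → SetoidMembershipₚ.∈-++⁺ʳ setoid L>2 (A₂⊆L₂ (x∈A , x⁻¹≈x , x≉ε))
         ; (no x⁻¹≉x)  → SetoidMembershipₚ.∈-++⁺ˡ setoid (A>2⊆L>2 (x∈A , x⁻¹≉x)) })
      ¬¬-excluded-middle

p+2q+n≤n²⇒4p+8q+1≤[2n∸1]² : ∀ p q n → .{{NonZero n}} →
                            p + (q + q) + n ≤ n * n → 4 * p + 8 * q + 1 ≤ (2 * n ∸ 1) ^ 2
p+2q+n≤n²⇒4p+8q+1≤[2n∸1]² p q (suc k) count = +-cancelʳ-≤ (4 * k + 3) _ _ (begin
  4 * p + 8 * q + 1 + (4 * k + 3)  ≡⟨ scale p q k ⟩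
  4 * (p + (q + q) + suc k)        ≤⟨ *-monoʳ-≤ 4 count ⟩
  4 * (suc k * suc k)              ≡⟨ square k ⟩
  (1 + 2 * k) ^ 2 + (4 * k + 3)    ≡⟨ cong (λ m → (m ∸ 1) ^ 2 + (4 * k + 3)) (≡.sym (*-suc 2 k)) ⟩
  (2 * suc k ∸ 1) ^ 2 + (4 * k + 3) ∎)
  where
  open ≤-Reasoning
  scale : ∀ p q k → 4 * p + 8 * q + 1 + (4 * k + 3) ≡ 4 * (p + (q + q) + (1 + k))
  scale = solve-∀
  square : ∀ k → 4 * ((1 + k) * (1 + k)) ≡ (1 + 2 * k) * ((1 + 2 * k) * 1) + (4 * k + 3)
  square = solve-∀

r≤p+q⇒4r+1≤4p+8q+1 : ∀ r p q → r ≤ p + q → 4 * r + 1 ≤ 4 * p + 8 * q + 1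
r≤p+q⇒4r+1≤4p+8q+1 r p q r≤p+q = ≤-trans (+-monoˡ-≤ 1 (*-monoʳ-≤ 4 r≤p+q))
  (subst (4 * (p + q) + 1 ≤_) (regroup p q) (m≤m+n _ (4 * q)))
  where
  regroup : ∀ p q → 4 * (p + q) + 1 + 4 * q ≡ 4 * p + 8 * q + 1
  regroup = solve-∀

theorem3p1 : {c ℓ : Level} (G : Group c ℓ) (A : List (Group.Carrier G)) →
    SetoidUnique.Unique (Group.setoid G) A → A ≢ [] →
    (d p q r : ℕ) → IsDifferenceSize G A d →
    HasCard G (A>2 G A) p → HasCard G (A=2 G A) q → HasCard G (A>1 G A) r →
    (4 * p + 8 * q + 1 ≤ (2 * d ∸ 1) ^ 2) × (4 * r + 1 ≤ 4 * p + 8 * q + 1)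
theorem3p1 G A _ A≢[] _ _ _ _ ((B , _ , basis , ≡.refl) , _)
           (L>2 , L>2-unique , ≡.refl , L>2⇔A>2) (L₂ , L₂-unique , ≡.refl , L₂⇔A₂)
           (L>1 , L>1-unique , ≡.refl , L>1⇔A>1) =
    p+2q+n≤n²⇒4p+8q+1≤[2n∸1]² (length L>2) (length L₂) (length B) {{basis-nonZero G A≢[] basis}}
      (basis-count G basis L>2-unique (to L>2⇔A>2) L₂-unique (to L₂⇔A₂))
  , r≤p+q⇒4r+1≤4p+8q+1 (length L>1) (length L>2) (length L₂)
      (A>1-count G L>1-unique (to L>1⇔A>1) (from L>2⇔A>2) (from L₂⇔A₂))
  where
  open SetoidMembership (Group.setoid G) using (_∈_)
  to : ∀ {s} {S : Group.Carrier G → Set s} {L} → (∀ x → (x ∈ L) ⇔ S x) → ∀ {x} → x ∈ L → S x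
  to L⇔S = Equivalence.to (L⇔S _)
  from : ∀ {s} {S : Group.Carrier G → Set s} {L} → (∀ x → (x ∈ L) ⇔ S x) → ∀ {x} → S x → x ∈ L
  from L⇔S = Equivalence.from (L⇔S _)
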